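{- Let $A$ be a principally polarized abelian variety over $K=\mathbb{F}_q$ and $g\in\mathrm{Aut}_k(A)$. For $T\in\mathbb{N}$ put $\xi_g(Fr_K^T)=g\,({}^{Fr_K}g)({}^{Fr_K^2}g)\cdots({}^{Fr_K^{T-1}}g)$. Let $T_g$ be the smallest $T\in\mathbb{N}$ with $\xi_g(Fr_K^T)=\mathrm{id}$, and let $c_g$ be the smallest $c\in\mathbb{N}$ such that $\xi_g(Fr_K^c)$ is defined over $K_c$. Then $c_g$ divides $T_g$, and $T_g/c_g$ equals the order of $G:=\xi_g(Fr_K^{c_g})=g({}^{Fr_K}g)\cdots({}^{Fr_K^{c_g-1}}g)$.
   Context: $k=\overline{\mathbb{F}}_p$, $K_c$ the degree-$c$ extension of $K$, $Fr_K:\alpha\mapsto\alpha^q$ the generator of $\mathrm{Gal}(k/K)$. $\mathrm{Aut}_k(A)$ is the group of automorphisms of $A\times_Kk$ preserving the polarization, and for $\tau\in\mathrm{Aut}_k(A)$, ${}^{Fr_K}\tau=Fr_K\circ\tau\circ Fr_K^{ -1}$ (acting on $k$-points). -}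

module Defs where

open import Level using (Level)
open import Data.Nat using (ℕ; zero; suc; _≤_; _<_)
open import Data.Fin using (Fin)
open import Data.Product using (Σ; _×_)
open import Algebra.Bundles using (Group)
open import Algebra.Morphism.Structures using (IsGroupIsomorphism)

iter : ∀ {a} {A : Set a} → (A → A) → ℕ → A → A
iter f zero    x = x
iter f (suc n) x = f (iter f n x)

IsLeastPositive : ∀ {p} → (ℕ → Set p) → ℕ → Set p
IsLeastPositive P n = (1 ≤ n) × P n × (∀ m → 1 ≤ m → P m → n ≤ m)

module _ {c ℓ : Level} (Γ : Group c ℓ) where
  open Group Γ

  IsAutomorphism : (Carrier → Carrier) → Set (c Level.⊔ ℓ)
  IsAutomorphism σ = IsGroupIsomorphism rawGroup rawGroup σ

  IsFinite : Set (c Level.⊔ ℓ)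
  IsFinite = Σ ℕ λ n → Σ (Fin n → Carrier) λ e → ∀ x → Σ (Fin n) λ i → e i ≈ x

  pow : Carrier → ℕ → Carrier
  pow x zero    = ε
  pow x (suc k) = pow x k ∙ x

  IsOrderOf : Carrier → ℕ → Set ℓ
  IsOrderOf x = IsLeastPositive (λ k → pow x k ≈ ε)

  -- ^{σ^n} τ = τ, i.e. τ is defined over K_n when σ = conjugation by Fr_K
  DefinedOver : (Carrier → Carrier) → ℕ → Carrier → Set ℓ
  DefinedOver σ n τ = iter σ n τ ≈ τ

  ξ : (Carrier → Carrier) → Carrier → ℕ → Carrier
  ξ σ g zero    = ε
  ξ σ g (suc T) = ξ σ g T ∙ iter σ T g

-- The map n ↦ ξ n = ξ_g(Fr^n) is a cocycle: ξ (a + b) = ξ a · σᵃ(ξ b). If σᶜ fixes G = ξ c,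
-- this gives ξ (q c) = G^q. Writing T = q c + r with r < c, ξ T = id makes σᵀ fix every ξ n,
-- hence σʳ fixes ξ (q c), so ξ r = ξ (q c)⁻¹ is defined over K_r and minimality of c forces
-- r = 0. Then ξ (m c) = id iff G^m = id, so minimality of T = q c is minimality of q.
module Submission where

open import Defs
open import Level using (Level)
open import Data.Nat using (ℕ; zero; suc; _≤_; _<_; _*_; _+_; NonZero; >-nonZero⁻¹; z≤n; s≤s; _%_; _/_)
open import Data.Nat.Properties using (+-comm; +-identityʳ; +-suc; <⇒≱; *-cancelʳ-≤; *-mono-≤)
open import Data.Nat.DivMod using (m≡m%n+[m/n]*n; m%n<n)
open import Data.Product using (Σ; _×_; _,_)
open import Data.Empty using (⊥-elim)
open import Relation.Binary.PropositionalEquality as ≡ using (_≡_)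
open import Algebra.Bundles using (Group)
open import Algebra.Morphism.Structures using (IsGroupHomomorphism; IsGroupIsomorphism)
import Algebra.Morphism.Construct.Composition as Composition
import Algebra.Morphism.Construct.Identity as Identity
import Algebra.Properties.Group as GroupProperties
import Relation.Binary.Reasoning.Setoid as SetoidReasoning

iter-+ : ∀ {a} {A : Set a} (f : A → A) m n x → iter f (m + n) x ≡ iter f m (iter f n x)
iter-+ f zero    n x = ≡.refl
iter-+ f (suc m) n x = ≡.cong f (iter-+ f m n x)

iter-comm : ∀ {a} {A : Set a} (f : A → A) m n x → iter f m (iter f n x) ≡ iter f n (iter f m x)
iter-comm f m n x = begin
  iter f m (iter f n x) ≡⟨ iter-+ f m n x ⟨
  iter f (m + n) x      ≡⟨ ≡.cong (λ k → iter f k x) (+-comm m n) ⟩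
  iter f (n + m) x      ≡⟨ iter-+ f n m x ⟩
  iter f n (iter f m x) ∎
  where open ≡.≡-Reasoning

module _ {p} {P : ℕ → Set p} where

  <-leastPositive⇒≡0 : ∀ {c r} → IsLeastPositive P c → r < c → P r → r ≡ 0
  <-leastPositive⇒≡0 {r = zero}  _                r<c Pr = ≡.refl
  <-leastPositive⇒≡0 {r = suc r} (_ , _ , minimal) r<c Pr = ⊥-elim (<⇒≱ r<c (minimal (suc r) (s≤s z≤n) Pr))

  isLeastPositive-*ʳ : ∀ {q} c .{{_ : NonZero c}} →
                       IsLeastPositive P (q * c) → IsLeastPositive (λ m → P (m * c)) q
  isLeastPositive-*ʳ {zero}  c (() , _)
  isLeastPositive-*ʳ {suc q} c (_ , Pqc , minimal) =
    s≤s z≤n , Pqc , λ m 1≤m Pmc → *-cancelʳ-≤ (suc q) m c (minimal (m * c) (*-mono-≤ 1≤m (>-nonZero⁻¹ c)) Pmc)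

isLeastPositive-⇔ : ∀ {p q} {P : ℕ → Set p} {Q : ℕ → Set q} {n} →
                    (∀ {m} → P m → Q m) → (∀ {m} → Q m → P m) → IsLeastPositive P n → IsLeastPositive Q n
isLeastPositive-⇔ P⇒Q Q⇒P (1≤n , Pn , minimal) = 1≤n , P⇒Q Pn , λ m 1≤m Qm → minimal m 1≤m (Q⇒P Qm)

module _ {c ℓ : Level} (Γ : Group c ℓ) {σ : Group.Carrier Γ → Group.Carrier Γ}
         (σ-homo : IsGroupHomomorphism (Group.rawGroup Γ) (Group.rawGroup Γ) σ) where
  open Group Γ
  open GroupProperties Γ using (inverseˡ-unique)
  open SetoidReasoning setoid

  iter-isGroupHomomorphism : ∀ n → IsGroupHomomorphism rawGroup rawGroup (iter σ n)
  iter-isGroupHomomorphism zero    = Identity.isGroupHomomorphism rawGroup refl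
  iter-isGroupHomomorphism (suc n) = Composition.isGroupHomomorphism trans (iter-isGroupHomomorphism n) σ-homo

  module Iter (n : ℕ) = IsGroupHomomorphism (iter-isGroupHomomorphism n)

  module _ (n : ℕ) where

    definedOver-resp : ∀ {x y} → x ≈ y → DefinedOver Γ σ n x → DefinedOver Γ σ n y
    definedOver-resp {x} {y} x≈y σⁿx≈x = begin
      iter σ n y ≈⟨ Iter.⟦⟧-cong n x≈y ⟨
      iter σ n x ≈⟨ σⁿx≈x ⟩
      x          ≈⟨ x≈y ⟩
      y          ∎

    definedOver-ε : DefinedOver Γ σ n ε
    definedOver-ε = Iter.ε-homo n

    definedOver-∙ : ∀ {x y} → DefinedOver Γ σ n x → DefinedOver Γ σ n y → DefinedOver Γ σ n (x ∙ y)
    definedOver-∙ σⁿx≈x σⁿy≈y = trans (Iter.homo n _ _) (∙-cong σⁿx≈x σⁿy≈y)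

    definedOver-⁻¹ : ∀ {x} → DefinedOver Γ σ n x → DefinedOver Γ σ n (x ⁻¹)
    definedOver-⁻¹ σⁿx≈x = trans (Iter.⁻¹-homo n _) (⁻¹-cong σⁿx≈x)

    definedOver-pow : ∀ {x} k → DefinedOver Γ σ n x → DefinedOver Γ σ n (pow Γ x k)
    definedOver-pow zero    _     = definedOver-ε
    definedOver-pow (suc k) σⁿx≈x = definedOver-∙ (definedOver-pow k σⁿx≈x) σⁿx≈x

    definedOver-iter : ∀ {x} m → DefinedOver Γ σ n x → DefinedOver Γ σ n (iter σ m x)
    definedOver-iter {x} m σⁿx≈x = begin
      iter σ n (iter σ m x) ≡⟨ iter-comm σ n m x ⟩
      iter σ m (iter σ n x) ≈⟨ Iter.⟦⟧-cong m σⁿx≈x ⟩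
      iter σ m x            ∎

    definedOver-* : ∀ {x} k → DefinedOver Γ σ n x → DefinedOver Γ σ (k * n) x
    definedOver-* zero        _     = refl
    definedOver-* {x} (suc k) σⁿx≈x = begin
      iter σ (n + k * n) x         ≡⟨ iter-+ σ n (k * n) x ⟩
      iter σ n (iter σ (k * n) x)  ≈⟨ Iter.⟦⟧-cong n (definedOver-* k σⁿx≈x) ⟩
      iter σ n x                   ≈⟨ σⁿx≈x ⟩
      x                            ∎

  definedOver-+-cancelʳ : ∀ {x} m n → DefinedOver Γ σ n x → DefinedOver Γ σ (m + n) x → DefinedOver Γ σ m x
  definedOver-+-cancelʳ {x} m n σⁿx≈x σᵐ⁺ⁿx≈x = begin
    iter σ m x            ≈⟨ Iter.⟦⟧-cong m σⁿx≈x ⟨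
    iter σ m (iter σ n x) ≡⟨ iter-+ σ m n x ⟨
    iter σ (m + n) x      ≈⟨ σᵐ⁺ⁿx≈x ⟩
    x                     ∎

  module _ (g : Carrier) where

    ξ-+ : ∀ m n → ξ Γ σ g (m + n) ≈ ξ Γ σ g m ∙ iter σ m (ξ Γ σ g n)
    ξ-+ m zero = begin
      ξ Γ σ g (m + 0)            ≡⟨ ≡.cong (ξ Γ σ g) (+-identityʳ m) ⟩
      ξ Γ σ g m                  ≈⟨ identityʳ _ ⟨
      ξ Γ σ g m ∙ ε              ≈⟨ ∙-congˡ (Iter.ε-homo m) ⟨
      ξ Γ σ g m ∙ iter σ m ε     ∎
    ξ-+ m (suc n) = begin
      ξ Γ σ g (m + suc n)                                       ≡⟨ ≡.cong (ξ Γ σ g) (+-suc m n) ⟩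
      ξ Γ σ g (m + n) ∙ iter σ (m + n) g                        ≈⟨ ∙-congʳ (ξ-+ m n) ⟩
      (ξ Γ σ g m ∙ iter σ m (ξ Γ σ g n)) ∙ iter σ (m + n) g     ≈⟨ ∙-congˡ (reflexive (iter-+ σ m n g)) ⟩
      (ξ Γ σ g m ∙ iter σ m (ξ Γ σ g n)) ∙ iter σ m (iter σ n g) ≈⟨ assoc _ _ _ ⟩
      ξ Γ σ g m ∙ (iter σ m (ξ Γ σ g n) ∙ iter σ m (iter σ n g)) ≈⟨ ∙-congˡ (Iter.homo m _ _) ⟨
      ξ Γ σ g m ∙ iter σ m (ξ Γ σ g (suc n))                   ∎

    ξ≈ε⇒definedOver : ∀ T → ξ Γ σ g T ≈ ε → ∀ n → DefinedOver Γ σ T (ξ Γ σ g n)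
    ξ≈ε⇒definedOver T ξT≈ε = definedOver-ξ
      where
      g-definedOver : DefinedOver Γ σ T g
      g-definedOver = begin
        iter σ T g                 ≈⟨ identityˡ _ ⟨
        ε ∙ iter σ T g             ≈⟨ ∙-congʳ ξT≈ε ⟨
        ξ Γ σ g (1 + T)            ≈⟨ ξ-+ 1 T ⟩
        ξ Γ σ g 1 ∙ σ (ξ Γ σ g T)  ≈⟨ ∙-congˡ (Iter.⟦⟧-cong 1 ξT≈ε) ⟩
        ξ Γ σ g 1 ∙ σ ε            ≈⟨ ∙-congˡ (Iter.ε-homo 1) ⟩
        ξ Γ σ g 1 ∙ ε              ≈⟨ identityʳ _ ⟩
        ε ∙ g                      ≈⟨ identityˡ g ⟩
        g                          ∎

      definedOver-ξ : ∀ n → DefinedOver Γ σ T (ξ Γ σ g n)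
      definedOver-ξ zero    = definedOver-ε T
      definedOver-ξ (suc n) = definedOver-∙ T (definedOver-ξ n) (definedOver-iter T n g-definedOver)

    module _ {c : ℕ} (ξc-definedOver : DefinedOver Γ σ c (ξ Γ σ g c)) where

      ξ-* : ∀ q → ξ Γ σ g (q * c) ≈ pow Γ (ξ Γ σ g c) q
      ξ-* zero    = refl
      ξ-* (suc q) = begin
        ξ Γ σ g (c + q * c)                                 ≡⟨ ≡.cong (ξ Γ σ g) (+-comm c (q * c)) ⟩
        ξ Γ σ g (q * c + c)                                 ≈⟨ ξ-+ (q * c) c ⟩
        ξ Γ σ g (q * c) ∙ iter σ (q * c) (ξ Γ σ g c)        ≈⟨ ∙-cong (ξ-* q) (definedOver-* c q ξc-definedOver) ⟩
        pow Γ (ξ Γ σ g c) q ∙ ξ Γ σ g c                     ∎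

      ξ-remainder-definedOver : ∀ q r → ξ Γ σ g (r + q * c) ≈ ε → DefinedOver Γ σ r (ξ Γ σ g r)
      ξ-remainder-definedOver q r ξ[r+qc]≈ε = definedOver-resp r (sym ξr≈ξqc⁻¹) (definedOver-⁻¹ r σ^r-fixes)
        where
        σ^qc-fixes : DefinedOver Γ σ (q * c) (ξ Γ σ g (q * c))
        σ^qc-fixes = definedOver-resp (q * c) (sym (ξ-* q)) (definedOver-* c q (definedOver-pow c q ξc-definedOver))

        σ^T-fixes : DefinedOver Γ σ (r + q * c) (ξ Γ σ g (q * c))
        σ^T-fixes = ξ≈ε⇒definedOver (r + q * c) ξ[r+qc]≈ε (q * c)

        σ^r-fixes : DefinedOver Γ σ r (ξ Γ σ g (q * c))
        σ^r-fixes = definedOver-+-cancelʳ r (q * c) σ^qc-fixes σ^T-fixes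

        ξr≈ξqc⁻¹ : ξ Γ σ g r ≈ ξ Γ σ g (q * c) ⁻¹
        ξr≈ξqc⁻¹ = inverseˡ-unique _ _ (begin
          ξ Γ σ g r ∙ ξ Γ σ g (q * c)             ≈⟨ ∙-congˡ σ^r-fixes ⟨
          ξ Γ σ g r ∙ iter σ r (ξ Γ σ g (q * c))  ≈⟨ ξ-+ r (q * c) ⟨
          ξ Γ σ g (r + q * c)                     ≈⟨ ξ[r+qc]≈ε ⟩
          ε                                       ∎)

-- Finiteness of Γ and of the order of σ only guarantee that T and c exist; both are given here.
lemma3p8 : ∀ {c ℓ : Level} (Γ : Group c ℓ) (σ : Group.Carrier Γ → Group.Carrier Γ)
    → IsAutomorphism Γ σ
    → IsFinite Γ
    → Σ ℕ (λ m → (1 ≤ m) × (∀ x → Group._≈_ Γ (iter σ m x) x))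
    → (g : Group.Carrier Γ) (T c : ℕ)
    → IsLeastPositive (λ t → Group._≈_ Γ (ξ Γ σ g t) (Group.ε Γ)) T
    → IsLeastPositive (λ n → DefinedOver Γ σ n (ξ Γ σ g n)) c
    → Σ ℕ (λ q → (T ≡ q * c) × IsOrderOf Γ (ξ Γ σ g c) q)
lemma3p8 Γ σ aut _ _ g T zero _ (() , _)
lemma3p8 Γ σ aut _ _ g T c@(suc _) T-least@(_ , ξT≈ε , _) c-least@(_ , ξc-definedOver , _) =
  T / c , T≡qc , isLeastPositive-⇔ (λ {m} → trans (sym (ξ-mc≈Gᵐ m))) (λ {m} → trans (ξ-mc≈Gᵐ m))
                    (isLeastPositive-*ʳ c (≡.subst (IsLeastPositive _) T≡qc T-least))
  where
  open Group Γ using (_≈_; ε; trans; sym; rawGroup)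

  σ-homo : IsGroupHomomorphism rawGroup rawGroup σ
  σ-homo = IsGroupIsomorphism.isGroupHomomorphism aut

  ξ-mc≈Gᵐ : ∀ m → ξ Γ σ g (m * c) ≈ pow Γ (ξ Γ σ g c) m
  ξ-mc≈Gᵐ = ξ-* Γ σ-homo g ξc-definedOver

  T≡r+qc : T ≡ T % c + T / c * c
  T≡r+qc = m≡m%n+[m/n]*n T c

  r≡0 : T % c ≡ 0
  r≡0 = <-leastPositive⇒≡0 c-least (m%n<n T c)
          (ξ-remainder-definedOver Γ σ-homo g ξc-definedOver (T / c) (T % c)
            (≡.subst (λ t → ξ Γ σ g t ≈ ε) T≡r+qc ξT≈ε))

  T≡qc : T ≡ T / c * c
  T≡qc = ≡.trans T≡r+qc (≡.cong (_+ T / c * c) r≡0)
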